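{- Let $n\ge 4$, let $V$ be a set of $n$ elements, and let $a,b,c,e\in V$ be four distinct elements. Let $\pi$ be a uniformly random bijection $V\to\{1,\dots,n\}$, and set $d_1=|\pi(a)-\pi(b)|$ and $d_2=|\pi(c)-\pi(e)|$ (the lengths of two vertex-disjoint edges). Then $$\mathbb{E}[d_1d_2]=\frac{1}{45}(n+1)(5n+4).$$
   Context: Here $\pi$ is chosen uniformly among all $n!$ bijections (a uniformly random linear arrangement of $V$). -}

module Defs where

open import Data.Nat using (ℕ; ∣_-_∣; _*_)
open import Data.Fin using (Fin; toℕ)
open import Data.List using (List; length; lookup)
open import Data.Product using (Σ; _×_)
open import Relation.Binary.PropositionalEquality using (_≡_; _≗_)
open import Function.Definitions using (Bijective)

-- A (linear arrangement) bijection V → {1..n}, with V = Fin n and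
-- positions shifted by one to Fin n = {0..n-1} (differences are unchanged).
IsPerm : (n : ℕ) → (Fin n → Fin n) → Set
IsPerm n π = Bijective _≡_ _≡_ π

-- L lists every bijection Fin n → Fin n exactly once (up to pointwise equality),
-- and only bijections.  Averaging over L = expectation under the uniform
-- distribution on the n! bijections.
EnumeratesPerms : (n : ℕ) → List (Fin n → Fin n) → Set
EnumeratesPerms n L =
  ((i : Fin (length L)) → IsPerm n (lookup L i)) ×
  ((f : Fin n → Fin n) → IsPerm n f →
     Σ (Fin (length L)) λ i → (lookup L i ≗ f) × ((j : Fin (length L)) → lookup L j ≗ f → j ≡ i))

dist : {n : ℕ} → (Fin n → Fin n) → Fin n → Fin n → ℕ
dist π x y = ∣ toℕ (π x) - toℕ (π y) ∣

-- Let C be the number of listed permutations sending (a, b, c, e) to (a, b, c, e).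
-- Post-composing with a permutation σ permutes the list, so the number sending
-- (a, b, c, e) to (x, y, z, w) is invariant under relabelling by σ; four
-- transpositions carry any distinct quadruple to (a, b, c, e), hence that number
-- is C on distinct quadruples and 0 otherwise.  Thus the sum of d₁ d₂ over the
-- list is C · T, where T sums |x - y| |z - w| over injective quadruples, while
-- the length of the list is C · n(n - 1)(n - 2)(n - 3).
-- For a symmetric weight f with zero diagonal, inclusion–exclusion gives
-- T + 4 Q = P² + 2 R with P = Σ f, R = Σ f² and Q the sum of the squared row
-- sums.  For f = |x - y| induction on n yields 3 P = n³ - n, 6 R = n⁴ - n² and
-- 60 Q = 7 n⁵ - 15 n³ + 8 n, and what remains is polynomial algebra.
module Submission where

open import Defs
import Data.Nat.Properties as ℕ
open import Algebra.Properties.Semiring.Sum ℕ.+-*-semiring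
  using (sum-syntax; sum-cong-≗; sum-permute; ∑-comm; ∑-distrib-+; *-distribˡ-sum; *-distribʳ-sum; sum-replicate-zero)
  renaming (sum to ∑)
open import Algebra.Properties.CommutativeSemigroup ℕ.*-commutativeSemigroup using (x∙yz≈y∙xz)
open import Data.Bool using (true; false; if_then_else_)
open import Data.Fin using (Fin; zero; suc; toℕ; _≟_)
open import Data.Fin.Properties using (toℕ<n)
import Data.Fin.Permutation as Perm
open import Data.Fin.Permutation using (Permutation; _⟨$⟩ʳ_; _⟨$⟩ˡ_)
import Data.Fin.Permutation.Components as PC
open import Data.List using (List; []; _∷_; length; map; lookup)
open import Data.Nat using (ℕ; zero; suc; _+_; _*_; _∸_; _≤_; _<_; ∣_-_∣; s≤s)
open import Data.Nat.ListAction using (sum)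
open import Data.Nat.Tactic.RingSolver using (solve-∀)
open import Data.Product using (_×_; _,_; proj₁; proj₂)
open import Data.Sum using (_⊎_; inj₁; inj₂)
open import Function using (_∘_; Injective)
open import Function.Bundles using (Bijection)
import Function.Construct.Composition as Compose
open import Function.Properties.Inverse using (Inverse⇒Bijection)
open import Relation.Binary.PropositionalEquality
  using (_≡_; _≢_; refl; sym; trans; cong; cong₂; _≗_; module ≡-Reasoning)
open import Relation.Nullary using (¬_; Dec; does; yes; no; contradiction)
open import Relation.Nullary.Decidable using (dec-true; dec-false; _×-dec_; ¬?)

private variable
  n : ℕ

[_≡_] [_≢_] : Fin n → Fin n → ℕ
[ u ≡ v ] = if does (u ≟ v) then 1 else 0
[ u ≢ v ] = if does (u ≟ v) then 0 else 1

[≢]-true : {u v : Fin n} → u ≢ v → [ u ≢ v ] ≡ 1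
[≢]-true {u = u} {v} u≢v = cong (λ b → if b then 0 else 1) (dec-false (u ≟ v) u≢v)

[≡]-injective : (f : Fin n → Fin n) → Injective _≡_ _≡_ f →
                (x y : Fin n) → [ f x ≡ f y ] ≡ [ x ≡ y ]
[≡]-injective f inj x y with x ≟ y
... | yes refl = cong (λ b → if b then 1 else 0) (dec-true (f x ≟ f x) refl)
... | no x≢y = cong (λ b → if b then 1 else 0) (dec-false (f x ≟ f y) (x≢y ∘ inj))

[≢]+[≡] : (u v : Fin n) (m : ℕ) → m ≡ [ u ≢ v ] * m + [ u ≡ v ] * m
[≢]+[≡] u v m with does (u ≟ v)
... | true = sym (ℕ.+-identityʳ m)
... | false = sym (trans (ℕ.+-identityʳ (m + 0)) (ℕ.+-identityʳ m))

∑-const : (n : ℕ) (c : ℕ) → ∑[ x < n ] c ≡ n * c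
∑-const zero c = refl
∑-const (suc n) c = cong (c +_) (∑-const n c)

∑-*ˡ : (k : ℕ) (g : Fin n → ℕ) → ∑[ x < n ] (k * g x) ≡ k * ∑[ x < n ] g x
∑-*ˡ k g = sym (*-distribˡ-sum k g)

∑-*ʳ : (k : ℕ) (g : Fin n → ℕ) → ∑[ x < n ] (g x * k) ≡ ∑[ x < n ] g x * k
∑-*ʳ k g = sym (*-distribʳ-sum k g)

-- The second clause needs no work: _≟_ on two successors is a map′ of the
-- recursive call, so [ suc u ≡ suc x ] reduces to [ u ≡ x ].
∑-[≡] : (u : Fin n) (g : Fin n → ℕ) → ∑[ x < n ] ([ u ≡ x ] * g x) ≡ g u
∑-[≡] {suc n} zero g = trans (cong₂ _+_ (ℕ.+-identityʳ (g zero)) (sum-replicate-zero n)) (ℕ.+-identityʳ (g zero))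
∑-[≡] {suc n} (suc u) g = ∑-[≡] u (g ∘ suc)

∑-remove : (u : Fin n) (g : Fin n → ℕ) → ∑[ x < n ] g x ≡ ∑[ x < n ] ([ u ≢ x ] * g x) + g u
∑-remove {n} u g = begin
  ∑[ x < n ] g x                                         ≡⟨ sum-cong-≗ (λ x → [≢]+[≡] u x (g x)) ⟩
  ∑[ x < n ] ([ u ≢ x ] * g x + [ u ≡ x ] * g x)         ≡⟨ ∑-distrib-+ (λ x → [ u ≢ x ] * g x) (λ x → [ u ≡ x ] * g x) ⟩
  ∑[ x < n ] ([ u ≢ x ] * g x) + ∑[ x < n ] ([ u ≡ x ] * g x) ≡⟨ cong (∑[ x < n ] ([ u ≢ x ] * g x) +_) (∑-[≡] u g) ⟩
  ∑[ x < n ] ([ u ≢ x ] * g x) + g u                     ∎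
  where open ≡-Reasoning

∑-remove₂ : {u v : Fin n} → u ≢ v → (g : Fin n → ℕ) →
            ∑[ x < n ] g x ≡ ∑[ x < n ] ([ u ≢ x ] * ([ v ≢ x ] * g x)) + g u + g v
∑-remove₂ {n} {u} {v} u≢v g = begin
  ∑[ x < n ] g x                                              ≡⟨ ∑-remove v g ⟩
  ∑[ x < n ] ([ v ≢ x ] * g x) + g v                          ≡⟨ cong (_+ g v) (∑-remove u (λ x → [ v ≢ x ] * g x)) ⟩
  ∑[ x < n ] ([ u ≢ x ] * ([ v ≢ x ] * g x)) + [ v ≢ u ] * g u + g v
    ≡⟨ cong (λ t → ∑[ x < n ] ([ u ≢ x ] * ([ v ≢ x ] * g x)) + t * g u + g v) ([≢]-true (u≢v ∘ sym)) ⟩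
  ∑[ x < n ] ([ u ≢ x ] * ([ v ≢ x ] * g x)) + 1 * g u + g v
    ≡⟨ cong (λ t → ∑[ x < n ] ([ u ≢ x ] * ([ v ≢ x ] * g x)) + t + g v) (ℕ.*-identityˡ (g u)) ⟩
  ∑[ x < n ] ([ u ≢ x ] * ([ v ≢ x ] * g x)) + g u + g v      ∎
  where open ≡-Reasoning

[≢]-guard : (u v : Fin n) {k l : ℕ} → (u ≢ v → k ≡ l) → [ u ≢ v ] * k ≡ [ u ≢ v ] * l
[≢]-guard u v k≡l with u ≟ v
... | yes _ = refl
... | no u≢v = cong (1 *_) (k≡l u≢v)

∑-avoid₁ : (u : Fin n) → ∑[ x < n ] [ u ≢ x ] + 1 ≡ n
∑-avoid₁ {n} u = begin
  ∑[ x < n ] [ u ≢ x ] + 1          ≡⟨ cong (_+ 1) (sum-cong-≗ (λ x → ℕ.*-identityʳ [ u ≢ x ])) ⟨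
  ∑[ x < n ] ([ u ≢ x ] * 1) + 1    ≡⟨ ∑-remove u (λ _ → 1) ⟨
  ∑[ x < n ] 1                      ≡⟨ ∑-const n 1 ⟩
  n * 1                             ≡⟨ ℕ.*-identityʳ n ⟩
  n                                 ∎
  where open ≡-Reasoning

∑-avoid₂ : {u v : Fin n} → u ≢ v → ∑[ x < n ] ([ u ≢ x ] * [ v ≢ x ]) + 2 ≡ n
∑-avoid₂ {n} {u} {v} u≢v = begin
  ∑[ x < n ] ([ u ≢ x ] * [ v ≢ x ]) + 2              ≡⟨ ℕ.+-assoc _ 1 1 ⟨
  ∑[ x < n ] ([ u ≢ x ] * [ v ≢ x ]) + 1 + 1
    ≡⟨ cong (λ s → s + 1 + 1) (sum-cong-≗ (λ x → cong ([ u ≢ x ] *_) (sym (ℕ.*-identityʳ [ v ≢ x ])))) ⟩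
  ∑[ x < n ] ([ u ≢ x ] * ([ v ≢ x ] * 1)) + 1 + 1    ≡⟨ ∑-remove₂ u≢v (λ _ → 1) ⟨
  ∑[ x < n ] 1                                        ≡⟨ ∑-const n 1 ⟩
  n * 1                                               ≡⟨ ℕ.*-identityʳ n ⟩
  n                                                   ∎
  where open ≡-Reasoning

∑-avoid₃ : {u v t : Fin n} → u ≢ v → u ≢ t → v ≢ t →
           ∑[ x < n ] ([ u ≢ x ] * ([ v ≢ x ] * [ t ≢ x ])) + 3 ≡ n
∑-avoid₃ {n} {u} {v} {t} u≢v u≢t v≢t = begin
  ∑[ x < n ] ([ u ≢ x ] * ([ v ≢ x ] * [ t ≢ x ])) + 3                      ≡⟨ ℕ.+-assoc _ 2 1 ⟨
  ∑[ x < n ] ([ u ≢ x ] * ([ v ≢ x ] * [ t ≢ x ])) + 2 + 1                  ≡⟨ cong (_+ 1) (ℕ.+-assoc _ 1 1) ⟨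
  ∑[ x < n ] ([ u ≢ x ] * ([ v ≢ x ] * [ t ≢ x ])) + 1 + 1 + 1
    ≡⟨ cong₂ (λ p q → ∑[ x < n ] ([ u ≢ x ] * ([ v ≢ x ] * [ t ≢ x ])) + p + q + 1)
             ([≢]-true (u≢t ∘ sym)) ([≢]-true (v≢t ∘ sym)) ⟨
  ∑[ x < n ] ([ u ≢ x ] * ([ v ≢ x ] * [ t ≢ x ])) + [ t ≢ u ] + [ t ≢ v ] + 1
    ≡⟨ cong (_+ 1) (∑-remove₂ u≢v (λ x → [ t ≢ x ])) ⟨
  ∑[ x < n ] [ t ≢ x ] + 1                                                  ≡⟨ ∑-avoid₁ t ⟩
  n                                                                         ∎
  where open ≡-Reasoning

Distinct : Fin n → Fin n → Fin n → Fin n → Set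
Distinct x y z w = x ≢ y × x ≢ z × x ≢ w × y ≢ z × y ≢ w × z ≢ w

Distinct-map : {x y z w x′ y′ z′ w′ : Fin n} (f : Fin n → Fin n) → Injective _≡_ _≡_ f →
               f x ≡ x′ → f y ≡ y′ → f z ≡ z′ → f w ≡ w′ → Distinct x y z w → Distinct x′ y′ z′ w′
Distinct-map f inj refl refl refl refl (x≢y , x≢z , x≢w , y≢z , y≢w , z≢w) =
  x≢y ∘ inj , x≢z ∘ inj , x≢w ∘ inj , y≢z ∘ inj , y≢w ∘ inj , z≢w ∘ inj

transpose-hits : (i j : Fin n) → PC.transpose i j i ≡ j
transpose-hits i j with i ≟ i
... | yes _ = refl
... | no i≢i = contradiction refl i≢i

transpose-fixes : {i j k : Fin n} → k ≢ i → k ≢ j → PC.transpose i j k ≡ k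
transpose-fixes {i = i} {j} {k} k≢i k≢j with k ≟ i
... | yes k≡i = contradiction k≡i k≢i
... | no _ with k ≟ j
...   | yes k≡j = contradiction k≡j k≢j
...   | no _ = refl

⟨$⟩ʳ-injective : (σ : Permutation n n) → Injective _≡_ _≡_ (σ ⟨$⟩ʳ_)
⟨$⟩ʳ-injective σ = proj₁ (Bijection.bijective (Inverse⇒Bijection σ))

distinct₄ : Fin n → Fin n → Fin n → Fin n → ℕ
distinct₄ x y z w = [ x ≢ y ] * ([ x ≢ z ] * ([ y ≢ z ] * ([ x ≢ w ] * ([ y ≢ w ] * [ z ≢ w ]))))

distinct? : (x y z w : Fin n) → Dec (Distinct x y z w)
distinct? x y z w = ¬? (x ≟ y) ×-dec ¬? (x ≟ z) ×-dec ¬? (x ≟ w) ×-dec ¬? (y ≟ z) ×-dec ¬? (y ≟ w) ×-dec ¬? (z ≟ w)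

distinct₄-true : {x y z w : Fin n} → Distinct x y z w → distinct₄ x y z w ≡ 1
distinct₄-true (x≢y , x≢z , x≢w , y≢z , y≢w , z≢w)
  rewrite [≢]-true x≢y | [≢]-true x≢z | [≢]-true y≢z | [≢]-true x≢w | [≢]-true y≢w | [≢]-true z≢w = refl

-- The products are right-nested, so a factor 0 preceded by factors 1 makes the
-- whole product reduce to 0; the same holds for match-support below.
distinct₄-false : {x y z w : Fin n} → ¬ Distinct x y z w → distinct₄ x y z w ≡ 0
distinct₄-false {x = x} {y} {z} {w} ¬d with x ≟ y | x ≟ z | y ≟ z | x ≟ w | y ≟ w | z ≟ w
... | yes _ | _     | _     | _     | _     | _     = refl
... | no _  | yes _ | _     | _     | _     | _     = refl
... | no _  | no _  | yes _ | _     | _     | _     = refl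
... | no _  | no _  | no _  | yes _ | _     | _     = refl
... | no _  | no _  | no _  | no _  | yes _ | _     = refl
... | no _  | no _  | no _  | no _  | no _  | yes _ = refl
... | no p  | no q  | no r  | no s  | no t  | no u  = contradiction (p , q , s , r , t , u) ¬d

∑⁴ : (Fin n → Fin n → Fin n → Fin n → ℕ) → ℕ
∑⁴ {n} G = ∑[ x < n ] ∑[ y < n ] ∑[ z < n ] ∑[ w < n ] G x y z w

∑⁴-cong : {G H : Fin n → Fin n → Fin n → Fin n → ℕ} →
          (∀ x y z w → G x y z w ≡ H x y z w) → ∑⁴ G ≡ ∑⁴ H
∑⁴-cong G≡H = sum-cong-≗ λ x → sum-cong-≗ λ y → sum-cong-≗ λ z → sum-cong-≗ λ w → G≡H x y z w

∑⁴-*ˡ : (k : ℕ) (G : Fin n → Fin n → Fin n → Fin n → ℕ) →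
        ∑⁴ (λ x y z w → k * G x y z w) ≡ k * ∑⁴ G
∑⁴-*ˡ {n} k G = sym (
  trans (*-distribˡ-sum k (λ x → ∑[ y < n ] ∑[ z < n ] ∑[ w < n ] G x y z w)) (sum-cong-≗ λ x →
  trans (*-distribˡ-sum k (λ y → ∑[ z < n ] ∑[ w < n ] G x y z w)) (sum-cong-≗ λ y →
  trans (*-distribˡ-sum k (λ z → ∑[ w < n ] G x y z w)) (sum-cong-≗ λ z →
  *-distribˡ-sum k (λ w → G x y z w)))))

∑-∑⁴-comm : {m : ℕ} (G : Fin m → Fin n → Fin n → Fin n → Fin n → ℕ) →
            ∑[ i < m ] ∑⁴ (G i) ≡ ∑⁴ (λ x y z w → ∑[ i < m ] G i x y z w)
∑-∑⁴-comm {n} G =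
  trans (∑-comm (λ i x → ∑[ y < n ] ∑[ z < n ] ∑[ w < n ] G i x y z w)) (sum-cong-≗ λ x →
  trans (∑-comm (λ i y → ∑[ z < n ] ∑[ w < n ] G i x y z w)) (sum-cong-≗ λ y →
  trans (∑-comm (λ i z → ∑[ w < n ] G i x y z w)) (sum-cong-≗ λ z →
  ∑-comm (λ i w → G i x y z w))))

∑⁴-[≡] : (u₁ u₂ u₃ u₄ : Fin n) (G : Fin n → Fin n → Fin n → Fin n → ℕ) →
         ∑⁴ (λ x y z w → [ u₁ ≡ x ] * ([ u₂ ≡ y ] * ([ u₃ ≡ z ] * [ u₄ ≡ w ])) * G x y z w) ≡ G u₁ u₂ u₃ u₄
∑⁴-[≡] u₁ u₂ u₃ u₄ G = trans (∑⁴-cong λ x y z w → reorder [ u₁ ≡ x ] [ u₂ ≡ y ] [ u₃ ≡ z ] [ u₄ ≡ w ] (G x y z w))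
  (trans (sum-cong-≗ λ x →
            trans (sum-cong-≗ λ y →
                     trans (sum-cong-≗ λ z → ∑-[≡] u₄ (λ w → [ u₃ ≡ z ] * ([ u₂ ≡ y ] * ([ u₁ ≡ x ] * G x y z w))))
                           (∑-[≡] u₃ (λ z → [ u₂ ≡ y ] * ([ u₁ ≡ x ] * G x y z u₄))))
                  (∑-[≡] u₂ (λ y → [ u₁ ≡ x ] * G x y u₃ u₄)))
         (∑-[≡] u₁ (λ x → G x u₂ u₃ u₄)))
  where
  reorder : ∀ p q r s g → p * (q * (r * s)) * g ≡ s * (r * (q * (p * g)))
  reorder = solve-∀

+⇒∸ : (s : ℕ) {k n : ℕ} → s + k ≡ n → s ≡ n ∸ k
+⇒∸ s {k} refl = sym (ℕ.m+n∸n≡m s k)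

∑⁴-distinct₄ : (n : ℕ) → ∑⁴ (distinct₄ {n}) ≡ n * ((n ∸ 1) * ((n ∸ 2) * (n ∸ 3)))
∑⁴-distinct₄ n = begin
  ∑⁴ (distinct₄ {n})
    ≡⟨ sum-cong-≗ (λ x → sum-cong-≗ λ y → sum-cong-≗ λ z → choose-w x y z) ⟩
  ∑[ x < n ] ∑[ y < n ] ∑[ z < n ] ([ x ≢ y ] * ([ x ≢ z ] * ([ y ≢ z ] * (n ∸ 3))))
    ≡⟨ sum-cong-≗ (λ x → sum-cong-≗ λ y → choose-z x y) ⟩
  ∑[ x < n ] ∑[ y < n ] ([ x ≢ y ] * ((n ∸ 2) * (n ∸ 3)))
    ≡⟨ sum-cong-≗ choose-y ⟩
  ∑[ x < n ] ((n ∸ 1) * ((n ∸ 2) * (n ∸ 3)))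
    ≡⟨ ∑-const n _ ⟩
  n * ((n ∸ 1) * ((n ∸ 2) * (n ∸ 3))) ∎
  where
  open ≡-Reasoning
  choose-w : (x y z : Fin n) → ∑[ w < n ] distinct₄ x y z w ≡ [ x ≢ y ] * ([ x ≢ z ] * ([ y ≢ z ] * (n ∸ 3)))
  choose-w x y z =
    trans (∑-*ˡ [ x ≢ y ] (λ w → [ x ≢ z ] * ([ y ≢ z ] * ([ x ≢ w ] * ([ y ≢ w ] * [ z ≢ w ]))))) ([≢]-guard x y λ x≢y →
    trans (∑-*ˡ [ x ≢ z ] (λ w → [ y ≢ z ] * ([ x ≢ w ] * ([ y ≢ w ] * [ z ≢ w ])))) ([≢]-guard x z λ x≢z →
    trans (∑-*ˡ [ y ≢ z ] (λ w → [ x ≢ w ] * ([ y ≢ w ] * [ z ≢ w ]))) ([≢]-guard y z λ y≢z →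
    +⇒∸ (∑[ w < n ] ([ x ≢ w ] * ([ y ≢ w ] * [ z ≢ w ]))) (∑-avoid₃ x≢y x≢z y≢z))))
  choose-z : (x y : Fin n) → ∑[ z < n ] ([ x ≢ y ] * ([ x ≢ z ] * ([ y ≢ z ] * (n ∸ 3)))) ≡ [ x ≢ y ] * ((n ∸ 2) * (n ∸ 3))
  choose-z x y =
    trans (∑-*ˡ [ x ≢ y ] (λ z → [ x ≢ z ] * ([ y ≢ z ] * (n ∸ 3)))) ([≢]-guard x y λ x≢y →
    trans (sum-cong-≗ (λ z → sym (ℕ.*-assoc [ x ≢ z ] [ y ≢ z ] (n ∸ 3))))
    (trans (∑-*ʳ (n ∸ 3) (λ z → [ x ≢ z ] * [ y ≢ z ])) (cong (_* (n ∸ 3)) (+⇒∸ (∑[ z < n ] ([ x ≢ z ] * [ y ≢ z ])) (∑-avoid₂ x≢y)))))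
  choose-y : (x : Fin n) → ∑[ y < n ] ([ x ≢ y ] * ((n ∸ 2) * (n ∸ 3))) ≡ (n ∸ 1) * ((n ∸ 2) * (n ∸ 3))
  choose-y x = trans (∑-*ʳ ((n ∸ 2) * (n ∸ 3)) (λ y → [ x ≢ y ])) (cong (_* ((n ∸ 2) * (n ∸ 3))) (+⇒∸ (∑[ y < n ] [ x ≢ y ]) (∑-avoid₁ x)))

sum-map : {A : Set} (g : A → ℕ) (L : List A) → sum (map g L) ≡ ∑[ i < length L ] g (lookup L i)
sum-map g [] = refl
sum-map g (x ∷ L) = cong (g x +_) (sum-map g L)

module Arrangements (L : List (Fin n → Fin n)) (enum : EnumeratesPerms n L) where

  private
    m : ℕ
    m = length L

    π : Fin m → Fin n → Fin n
    π = lookup L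

    index : (f : Fin n → Fin n) → IsPerm n f → Fin m
    index f f-perm = proj₁ (proj₂ enum f f-perm)

    π-index : (f : Fin n → Fin n) (f-perm : IsPerm n f) → π (index f f-perm) ≗ f
    π-index f f-perm = proj₁ (proj₂ (proj₂ enum f f-perm))

    index-unique : {i j : Fin m} → π i ≗ π j → i ≡ j
    index-unique {i} {j} πi≗πj = trans (unique i πi≗πj) (sym (unique j (λ _ → refl)))
      where unique = proj₂ (proj₂ (proj₂ enum (π j) (proj₁ enum j)))

    shift : Permutation n n → Fin m → Fin m
    shift σ i = index ((σ ⟨$⟩ʳ_) ∘ π i)
      (Compose.bijective _≡_ _≡_ _≡_ (proj₁ enum i) (Bijection.bijective (Inverse⇒Bijection σ)))

    π-shift : (σ : Permutation n n) (i : Fin m) → π (shift σ i) ≗ (σ ⟨$⟩ʳ_) ∘ π i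
    π-shift σ i = π-index _ _

    shift-inverse : (σ : Permutation n n) (i : Fin m) → shift σ (shift (Perm.flip σ) i) ≡ i
    shift-inverse σ i = index-unique λ x → begin
      π (shift σ (shift (Perm.flip σ) i)) x  ≡⟨ π-shift σ _ x ⟩
      σ ⟨$⟩ʳ π (shift (Perm.flip σ) i) x     ≡⟨ cong (σ ⟨$⟩ʳ_) (π-shift (Perm.flip σ) i x) ⟩
      σ ⟨$⟩ʳ (σ ⟨$⟩ˡ π i x)                  ≡⟨ Perm.inverseʳ σ ⟩
      π i x                                  ∎
      where open ≡-Reasoning

    relabel : Permutation n n → Permutation m m
    relabel σ = Perm.permutation (shift σ) (shift (Perm.flip σ))
                  (shift-inverse σ) (shift-inverse (Perm.flip σ))

  π-injective : (i : Fin m) → Injective _≡_ _≡_ (π i)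
  π-injective i = proj₁ (proj₁ enum i)

  ∑-relabel : (σ : Permutation n n) (F : (Fin n → Fin n) → ℕ) → (∀ {f g} → f ≗ g → F f ≡ F g) →
              ∑[ i < m ] F (π i) ≡ ∑[ i < m ] F ((σ ⟨$⟩ʳ_) ∘ π i)
  ∑-relabel σ F F-ext = trans (sum-permute (F ∘ π) (relabel σ)) (sum-cong-≗ (λ i → F-ext (π-shift σ i)))

  module Quadruple {a b c e : Fin n} (a≢b : a ≢ b) (a≢c : a ≢ c) (a≢e : a ≢ e)
                   (b≢c : b ≢ c) (b≢e : b ≢ e) (c≢e : c ≢ e) where

    match : (Fin n → Fin n) → Fin n → Fin n → Fin n → Fin n → ℕ
    match f x y z w = [ f a ≡ x ] * ([ f b ≡ y ] * ([ f c ≡ z ] * [ f e ≡ w ]))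

    count : Fin n → Fin n → Fin n → Fin n → ℕ
    count x y z w = ∑[ i < m ] match (π i) x y z w

    C : ℕ
    C = count a b c e

    match-cong : {f g : Fin n → Fin n} (x y z w : Fin n) → f ≗ g → match f x y z w ≡ match g x y z w
    match-cong x y z w f≗g =
      cong₂ _*_ (cong (λ t → [ t ≡ x ]) (f≗g a)) (cong₂ _*_ (cong (λ t → [ t ≡ y ]) (f≗g b))
        (cong₂ _*_ (cong (λ t → [ t ≡ z ]) (f≗g c)) (cong (λ t → [ t ≡ w ]) (f≗g e))))

    match-relabel : (σ : Permutation n n) (f : Fin n → Fin n) (x y z w : Fin n) →
                    match ((σ ⟨$⟩ʳ_) ∘ f) (σ ⟨$⟩ʳ x) (σ ⟨$⟩ʳ y) (σ ⟨$⟩ʳ z) (σ ⟨$⟩ʳ w) ≡ match f x y z w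
    match-relabel σ f x y z w =
      cong₂ _*_ ([≡]-injective _ σ-inj (f a) x) (cong₂ _*_ ([≡]-injective _ σ-inj (f b) y)
        (cong₂ _*_ ([≡]-injective _ σ-inj (f c) z) ([≡]-injective _ σ-inj (f e) w)))
      where σ-inj = ⟨$⟩ʳ-injective σ

    count-relabel : {x y z w x′ y′ z′ w′ : Fin n} (σ : Permutation n n) →
                    σ ⟨$⟩ʳ x ≡ x′ → σ ⟨$⟩ʳ y ≡ y′ → σ ⟨$⟩ʳ z ≡ z′ → σ ⟨$⟩ʳ w ≡ w′ →
                    count x y z w ≡ count x′ y′ z′ w′
    count-relabel {x} {y} {z} {w} σ refl refl refl refl = sym (begin
      ∑[ i < m ] match (π i) (σ ⟨$⟩ʳ x) (σ ⟨$⟩ʳ y) (σ ⟨$⟩ʳ z) (σ ⟨$⟩ʳ w)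
        ≡⟨ ∑-relabel σ (λ f → match f (σ ⟨$⟩ʳ x) (σ ⟨$⟩ʳ y) (σ ⟨$⟩ʳ z) (σ ⟨$⟩ʳ w)) (match-cong _ _ _ _) ⟩
      ∑[ i < m ] match ((σ ⟨$⟩ʳ_) ∘ π i) (σ ⟨$⟩ʳ x) (σ ⟨$⟩ʳ y) (σ ⟨$⟩ʳ z) (σ ⟨$⟩ʳ w)
        ≡⟨ sum-cong-≗ (λ i → match-relabel σ (π i) x y z w) ⟩
      ∑[ i < m ] match (π i) x y z w ∎)
      where open ≡-Reasoning

    private
      relabel-step : {x y z w x′ y′ z′ w′ : Fin n} (σ : Permutation n n) →
                     σ ⟨$⟩ʳ x ≡ x′ → σ ⟨$⟩ʳ y ≡ y′ → σ ⟨$⟩ʳ z ≡ z′ → σ ⟨$⟩ʳ w ≡ w′ → Distinct x y z w →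
                     (Distinct x′ y′ z′ w′ → count x′ y′ z′ w′ ≡ C) → count x y z w ≡ C
      relabel-step σ σx σy σz σw d continue =
        trans (count-relabel σ σx σy σz σw) (continue (Distinct-map _ (⟨$⟩ʳ-injective σ) σx σy σz σw d))

      count-aligned₃ : {w : Fin n} → Distinct a b c w → count a b c w ≡ C
      count-aligned₃ {w} d@(_ , _ , a≢w , _ , b≢w , c≢w) =
        relabel-step (Perm.transpose w e) (transpose-fixes a≢w a≢e) (transpose-fixes b≢w b≢e)
          (transpose-fixes c≢w c≢e) (transpose-hits w e) d (λ _ → refl)

      count-aligned₂ : {z w : Fin n} → Distinct a b z w → count a b z w ≡ C
      count-aligned₂ {z} d@(_ , a≢z , _ , b≢z , _ , _) =
        relabel-step (Perm.transpose z c) (transpose-fixes a≢z a≢c) (transpose-fixes b≢z b≢c)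
          (transpose-hits z c) refl d count-aligned₃

      count-aligned₁ : {y z w : Fin n} → Distinct a y z w → count a y z w ≡ C
      count-aligned₁ {y} d@(a≢y , _) =
        relabel-step (Perm.transpose y b) (transpose-fixes a≢y a≢b) (transpose-hits y b) refl refl d count-aligned₂

    count-distinct : {x y z w : Fin n} → Distinct x y z w → count x y z w ≡ C
    count-distinct {x} d = relabel-step (Perm.transpose x a) (transpose-hits x a) refl refl refl d count-aligned₁

    match-support : (f : Fin n → Fin n) (x y z w : Fin n) →
                    match f x y z w ≡ 0 ⊎ (f a ≡ x × f b ≡ y × f c ≡ z × f e ≡ w)
    match-support f x y z w with f a ≟ x | f b ≟ y | f c ≟ z | f e ≟ w
    ... | no _  | _     | _     | _     = inj₁ refl
    ... | yes _ | no _  | _     | _     = inj₁ refl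
    ... | yes _ | yes _ | no _  | _     = inj₁ refl
    ... | yes _ | yes _ | yes _ | no _  = inj₁ refl
    ... | yes p | yes q | yes r | yes s = inj₂ (p , q , r , s)

    count-nonDistinct : {x y z w : Fin n} → ¬ Distinct x y z w → count x y z w ≡ 0
    count-nonDistinct {x} {y} {z} {w} ¬d = trans (sum-cong-≗ match-zero) (sum-replicate-zero m)
      where
      match-zero : (i : Fin m) → match (π i) x y z w ≡ 0
      match-zero i with match-support (π i) x y z w
      ... | inj₁ match≡0 = match≡0
      ... | inj₂ (p , q , r , s) = contradiction (Distinct-map (π i) (π-injective i) p q r s (a≢b , a≢c , a≢e , b≢c , b≢e , c≢e)) ¬d

    count≡C*distinct₄ : (x y z w : Fin n) → count x y z w ≡ C * distinct₄ x y z w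
    count≡C*distinct₄ x y z w with distinct? x y z w
    ... | yes d = trans (count-distinct d) (sym (trans (cong (C *_) (distinct₄-true d)) (ℕ.*-identityʳ C)))
    ... | no ¬d = trans (count-nonDistinct ¬d) (sym (trans (cong (C *_) (distinct₄-false ¬d)) (ℕ.*-zeroʳ C)))

    ∑-arrangements : (F : Fin n → Fin n → Fin n → Fin n → ℕ) →
                     ∑[ i < m ] F (π i a) (π i b) (π i c) (π i e) ≡ C * ∑⁴ (λ x y z w → distinct₄ x y z w * F x y z w)
    ∑-arrangements F = begin
      ∑[ i < m ] F (π i a) (π i b) (π i c) (π i e)
        ≡⟨ sum-cong-≗ (λ i → ∑⁴-[≡] (π i a) (π i b) (π i c) (π i e) F) ⟨
      ∑[ i < m ] ∑⁴ (λ x y z w → match (π i) x y z w * F x y z w)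
        ≡⟨ ∑-∑⁴-comm (λ i x y z w → match (π i) x y z w * F x y z w) ⟩
      ∑⁴ (λ x y z w → ∑[ i < m ] (match (π i) x y z w * F x y z w))
        ≡⟨ ∑⁴-cong (λ x y z w → ∑-*ʳ (F x y z w) (λ i → match (π i) x y z w)) ⟩
      ∑⁴ (λ x y z w → count x y z w * F x y z w)
        ≡⟨ ∑⁴-cong (λ x y z w → trans (cong (_* F x y z w) (count≡C*distinct₄ x y z w))
                                       (ℕ.*-assoc C (distinct₄ x y z w) (F x y z w))) ⟩
      ∑⁴ (λ x y z w → C * (distinct₄ x y z w * F x y z w))
        ≡⟨ ∑⁴-*ˡ C (λ x y z w → distinct₄ x y z w * F x y z w) ⟩
      C * ∑⁴ (λ x y z w → distinct₄ x y z w * F x y z w) ∎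
      where open ≡-Reasoning

    length≡C*∑⁴distinct₄ : m ≡ C * ∑⁴ (distinct₄ {n})
    length≡C*∑⁴distinct₄ = begin
      m                                                 ≡⟨ ℕ.*-identityʳ m ⟨
      m * 1                                             ≡⟨ ∑-const m 1 ⟨
      ∑[ i < m ] 1                                      ≡⟨ ∑-arrangements (λ (_ _ _ _ : Fin n) → 1) ⟩
      C * ∑⁴ {n} (λ x y z w → distinct₄ x y z w * 1)    ≡⟨ cong (C *_) (∑⁴-cong {n} λ x y z w → ℕ.*-identityʳ (distinct₄ x y z w)) ⟩
      C * ∑⁴ (distinct₄ {n})                            ∎
      where open ≡-Reasoning

∑² : (Fin n → Fin n → ℕ) → ℕ
∑² {n} G = ∑[ x < n ] ∑[ y < n ] G x y

∑²-cong : {G H : Fin n → Fin n → ℕ} → (∀ x y → G x y ≡ H x y) → ∑² G ≡ ∑² H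
∑²-cong G≡H = sum-cong-≗ λ x → sum-cong-≗ λ y → G≡H x y

∑²-+ : (G H : Fin n → Fin n → ℕ) → ∑² (λ x y → G x y + H x y) ≡ ∑² G + ∑² H
∑²-+ {n} G H = trans (sum-cong-≗ λ x → ∑-distrib-+ (G x) (H x)) (∑-distrib-+ (λ x → ∑[ y < n ] G x y) (λ x → ∑[ y < n ] H x y))

∑²-*ˡ : (k : ℕ) (G : Fin n → Fin n → ℕ) → ∑² (λ x y → k * G x y) ≡ k * ∑² G
∑²-*ˡ {n} k G = trans (sum-cong-≗ λ x → ∑-*ˡ k (G x)) (∑-*ˡ k (λ x → ∑[ y < n ] G x y))

module SymmetricWeight {n : ℕ} (f : Fin n → Fin n → ℕ)
                       (f-diag : ∀ x → f x x ≡ 0) (f-sym : ∀ x y → f x y ≡ f y x) where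

  row : Fin n → ℕ
  row x = ∑[ y < n ] f x y

  total : ℕ
  total = ∑[ x < n ] row x

  rowAvoiding : Fin n → Fin n → Fin n → ℕ
  rowAvoiding x y z = ∑[ w < n ] ([ x ≢ w ] * ([ y ≢ w ] * f z w))

  totalAvoiding : Fin n → Fin n → ℕ
  totalAvoiding x y = ∑[ z < n ] ([ x ≢ z ] * ([ y ≢ z ] * rowAvoiding x y z))

  f-guard : (x y : Fin n) {k l : ℕ} → (x ≢ y → k ≡ l) → f x y * k ≡ f x y * l
  f-guard x y {k} {l} k≡l with x ≟ y
  ... | yes refl = trans (cong (_* k) (f-diag x)) (sym (cong (_* l) (f-diag x)))
  ... | no x≢y = cong (f x y *_) (k≡l x≢y)

  [≢]*f≡f : (x y : Fin n) → [ x ≢ y ] * f x y ≡ f x y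
  [≢]*f≡f x y with x ≟ y
  ... | yes refl = sym (f-diag x)
  ... | no _ = ℕ.+-identityʳ (f x y)

  column≡row : (x : Fin n) → ∑[ z < n ] f z x ≡ row x
  column≡row x = sum-cong-≗ λ z → f-sym z x

  row-split : {x y : Fin n} → x ≢ y → row x ≡ rowAvoiding x y x + f x y
  row-split {x} {y} x≢y = begin
    row x                                    ≡⟨ ∑-remove₂ x≢y (f x) ⟩
    rowAvoiding x y x + f x x + f x y           ≡⟨ cong (λ t → rowAvoiding x y x + t + f x y) (f-diag x) ⟩
    rowAvoiding x y x + 0 + f x y               ≡⟨ cong (_+ f x y) (ℕ.+-identityʳ (rowAvoiding x y x)) ⟩
    rowAvoiding x y x + f x y                   ∎
    where open ≡-Reasoning

  row-split′ : {x y : Fin n} → x ≢ y → row y ≡ rowAvoiding x y y + f x y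
  row-split′ {x} {y} x≢y = begin
    row y                                    ≡⟨ ∑-remove₂ x≢y (f y) ⟩
    rowAvoiding x y y + f y x + f y y           ≡⟨ cong₂ (λ s t → rowAvoiding x y y + s + t) (f-sym y x) (f-diag y) ⟩
    rowAvoiding x y y + f x y + 0               ≡⟨ ℕ.+-identityʳ _ ⟩
    rowAvoiding x y y + f x y                   ∎
    where open ≡-Reasoning

  total-split : {x y : Fin n} → x ≢ y → total ≡ ∑[ z < n ] rowAvoiding x y z + row x + row y
  total-split {x} {y} x≢y = begin
    ∑[ z < n ] row z
      ≡⟨ sum-cong-≗ (λ z → ∑-remove₂ x≢y (f z)) ⟩
    ∑[ z < n ] (rowAvoiding x y z + f z x + f z y)
      ≡⟨ ∑-distrib-+ (λ z → rowAvoiding x y z + f z x) (λ z → f z y) ⟩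
    ∑[ z < n ] (rowAvoiding x y z + f z x) + ∑[ z < n ] f z y
      ≡⟨ cong (_+ ∑[ z < n ] f z y) (∑-distrib-+ (rowAvoiding x y) (λ z → f z x)) ⟩
    ∑[ z < n ] rowAvoiding x y z + ∑[ z < n ] f z x + ∑[ z < n ] f z y
      ≡⟨ cong₂ (λ s t → ∑[ z < n ] rowAvoiding x y z + s + t) (column≡row x) (column≡row y) ⟩
    ∑[ z < n ] rowAvoiding x y z + row x + row y ∎
    where open ≡-Reasoning

  totalAvoiding+rows : {x y : Fin n} → x ≢ y → totalAvoiding x y + 2 * row x + 2 * row y ≡ total + 2 * f x y
  totalAvoiding+rows {x} {y} x≢y = begin
    totalAvoiding x y + 2 * row x + 2 * row y
      ≡⟨ cong₂ (λ s t → totalAvoiding x y + 2 * s + 2 * t) (row-split x≢y) (row-split′ x≢y) ⟩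
    totalAvoiding x y + 2 * (rowAvoiding x y x + f x y) + 2 * (rowAvoiding x y y + f x y)
      ≡⟨ regroup (totalAvoiding x y) (rowAvoiding x y x) (rowAvoiding x y y) (f x y) ⟩
    totalAvoiding x y + rowAvoiding x y x + rowAvoiding x y y + (rowAvoiding x y x + f x y) + (rowAvoiding x y y + f x y) + 2 * f x y
      ≡⟨ cong (λ t → t + (rowAvoiding x y x + f x y) + (rowAvoiding x y y + f x y) + 2 * f x y) (∑-remove₂ x≢y (rowAvoiding x y)) ⟨
    ∑[ z < n ] rowAvoiding x y z + (rowAvoiding x y x + f x y) + (rowAvoiding x y y + f x y) + 2 * f x y
      ≡⟨ cong₂ (λ s t → ∑[ z < n ] rowAvoiding x y z + s + t + 2 * f x y) (row-split x≢y) (row-split′ x≢y) ⟨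
    ∑[ z < n ] rowAvoiding x y z + row x + row y + 2 * f x y
      ≡⟨ cong (_+ 2 * f x y) (total-split x≢y) ⟨
    total + 2 * f x y ∎
    where
    open ≡-Reasoning
    regroup : ∀ o a b d → o + 2 * (a + d) + 2 * (b + d) ≡ o + a + b + (a + d) + (b + d) + 2 * d
    regroup = solve-∀

  distinct₄-weight : (x y z w : Fin n) →
    distinct₄ x y z w * (f x y * f z w) ≡ f x y * ([ x ≢ z ] * ([ y ≢ z ] * ([ x ≢ w ] * ([ y ≢ w ] * f z w))))
  distinct₄-weight x y z w = begin
    distinct₄ x y z w * (f x y * f z w)
      ≡⟨ regroup [ x ≢ y ] [ x ≢ z ] [ y ≢ z ] [ x ≢ w ] [ y ≢ w ] [ z ≢ w ] (f x y) (f z w) ⟩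
    [ x ≢ y ] * f x y * ([ x ≢ z ] * ([ y ≢ z ] * ([ x ≢ w ] * ([ y ≢ w ] * ([ z ≢ w ] * f z w)))))
      ≡⟨ cong₂ (λ s t → s * ([ x ≢ z ] * ([ y ≢ z ] * ([ x ≢ w ] * ([ y ≢ w ] * t))))) ([≢]*f≡f x y) ([≢]*f≡f z w) ⟩
    f x y * ([ x ≢ z ] * ([ y ≢ z ] * ([ x ≢ w ] * ([ y ≢ w ] * f z w)))) ∎
    where
    open ≡-Reasoning
    regroup : ∀ p q r s t u a b → p * (q * (r * (s * (t * u)))) * (a * b) ≡ p * a * (q * (r * (s * (t * (u * b)))))
    regroup = solve-∀

  ∑⁴-distinct₄-weight : ∑⁴ (λ x y z w → distinct₄ x y z w * (f x y * f z w)) ≡ ∑² (λ x y → f x y * totalAvoiding x y)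
  ∑⁴-distinct₄-weight = sum-cong-≗ λ x → sum-cong-≗ λ y →
    trans (sum-cong-≗ λ z → trans (sum-cong-≗ (distinct₄-weight x y z)) (pull x y z))
          (∑-*ˡ (f x y) (λ z → [ x ≢ z ] * ([ y ≢ z ] * rowAvoiding x y z)))
    where
    pull : (x y z : Fin n) →
           ∑[ w < n ] (f x y * ([ x ≢ z ] * ([ y ≢ z ] * ([ x ≢ w ] * ([ y ≢ w ] * f z w)))))
           ≡ f x y * ([ x ≢ z ] * ([ y ≢ z ] * rowAvoiding x y z))
    pull x y z =
      trans (∑-*ˡ (f x y) (λ w → [ x ≢ z ] * ([ y ≢ z ] * ([ x ≢ w ] * ([ y ≢ w ] * f z w))))) (cong (f x y *_)
      (trans (∑-*ˡ [ x ≢ z ] (λ w → [ y ≢ z ] * ([ x ≢ w ] * ([ y ≢ w ] * f z w)))) (cong ([ x ≢ z ] *_)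
      (∑-*ˡ [ y ≢ z ] (λ w → [ x ≢ w ] * ([ y ≢ w ] * f z w))))))

  pair-identity : (x y : Fin n) →
    f x y * totalAvoiding x y + 2 * (f x y * row x) + 2 * (f x y * row y) ≡ total * f x y + 2 * (f x y * f x y)
  pair-identity x y = begin
    f x y * totalAvoiding x y + 2 * (f x y * row x) + 2 * (f x y * row y)
      ≡⟨ factor (f x y) (totalAvoiding x y) (row x) (row y) ⟩
    f x y * (totalAvoiding x y + 2 * row x + 2 * row y)
      ≡⟨ f-guard x y totalAvoiding+rows ⟩
    f x y * (total + 2 * f x y)
      ≡⟨ expand (f x y) total ⟩
    total * f x y + 2 * (f x y * f x y) ∎
    where
    open ≡-Reasoning
    factor : ∀ d o r s → d * o + 2 * (d * r) + 2 * (d * s) ≡ d * (o + 2 * r + 2 * s)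
    factor = solve-∀
    expand : ∀ d t → d * (t + 2 * d) ≡ t * d + 2 * (d * d)
    expand = solve-∀

  ∑²-f*row : ∑² (λ x y → f x y * row x) ≡ ∑[ x < n ] (row x * row x)
  ∑²-f*row = sum-cong-≗ λ x → ∑-*ʳ (row x) (f x)

  ∑²-f*row′ : ∑² (λ x y → f x y * row y) ≡ ∑[ x < n ] (row x * row x)
  ∑²-f*row′ = trans (∑-comm (λ x y → f x y * row y))
                (sum-cong-≗ λ y → trans (∑-*ʳ (row y) (λ x → f x y)) (cong (_* row y) (column≡row y)))

  inclusion-exclusion :
    ∑⁴ (λ x y z w → distinct₄ x y z w * (f x y * f z w)) + 4 * ∑[ x < n ] (row x * row x)
    ≡ total * total + 2 * ∑² (λ x y → f x y * f x y)
  inclusion-exclusion = begin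
    ∑⁴ (λ x y z w → distinct₄ x y z w * (f x y * f z w)) + 4 * Q
      ≡⟨ cong₂ _+_ ∑⁴-distinct₄-weight (split Q) ⟩
    ∑² (λ x y → f x y * totalAvoiding x y) + (2 * Q + 2 * Q)
      ≡⟨ cong₂ (λ s t → ∑² (λ x y → f x y * totalAvoiding x y) + (2 * s + 2 * t)) ∑²-f*row ∑²-f*row′ ⟨
    ∑² (λ x y → f x y * totalAvoiding x y) + (2 * ∑² (λ x y → f x y * row x) + 2 * ∑² (λ x y → f x y * row y))
      ≡⟨ cong (∑² (λ x y → f x y * totalAvoiding x y) +_)
           (cong₂ _+_ (∑²-*ˡ 2 (λ x y → f x y * row x)) (∑²-*ˡ 2 (λ x y → f x y * row y))) ⟨
    ∑² (λ x y → f x y * totalAvoiding x y) + (∑² (λ x y → 2 * (f x y * row x)) + ∑² (λ x y → 2 * (f x y * row y)))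
      ≡⟨ cong (∑² (λ x y → f x y * totalAvoiding x y) +_) (∑²-+ (λ x y → 2 * (f x y * row x)) (λ x y → 2 * (f x y * row y))) ⟨
    ∑² (λ x y → f x y * totalAvoiding x y) + ∑² (λ x y → 2 * (f x y * row x) + 2 * (f x y * row y))
      ≡⟨ ∑²-+ (λ x y → f x y * totalAvoiding x y) (λ x y → 2 * (f x y * row x) + 2 * (f x y * row y)) ⟨
    ∑² (λ x y → f x y * totalAvoiding x y + (2 * (f x y * row x) + 2 * (f x y * row y)))
      ≡⟨ ∑²-cong (λ x y → trans (sym (ℕ.+-assoc (f x y * totalAvoiding x y) _ _)) (pair-identity x y)) ⟩
    ∑² (λ x y → total * f x y + 2 * (f x y * f x y))
      ≡⟨ ∑²-+ (λ x y → total * f x y) (λ x y → 2 * (f x y * f x y)) ⟩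
    ∑² (λ x y → total * f x y) + ∑² (λ x y → 2 * (f x y * f x y))
      ≡⟨ cong₂ _+_ (∑²-*ˡ total f) (∑²-*ˡ 2 (λ x y → f x y * f x y)) ⟩
    total * total + 2 * ∑² (λ x y → f x y * f x y) ∎
    where
    open ≡-Reasoning
    Q : ℕ
    Q = ∑[ x < n ] (row x * row x)
    split : ∀ q → 4 * q ≡ 2 * q + 2 * q
    split = solve-∀

∑< : ℕ → (ℕ → ℕ) → ℕ
∑< n g = ∑[ i < n ] g (toℕ i)

∑<-last : (n : ℕ) (g : ℕ → ℕ) → ∑< (suc n) g ≡ ∑< n g + g n
∑<-last zero g = ℕ.+-identityʳ (g 0)
∑<-last (suc n) g = trans (cong (g 0 +_) (∑<-last n (g ∘ suc))) (sym (ℕ.+-assoc (g 0) _ _))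

∑<-cong : (n : ℕ) {g h : ℕ → ℕ} → (∀ x → x < n → g x ≡ h x) → ∑< n g ≡ ∑< n h
∑<-cong n g≡h = sum-cong-≗ λ i → g≡h (toℕ i) (toℕ<n i)

∑<-+ : (n : ℕ) (g h : ℕ → ℕ) → ∑< n (λ x → g x + h x) ≡ ∑< n g + ∑< n h
∑<-+ n g h = ∑-distrib-+ {n} (g ∘ toℕ) (h ∘ toℕ)

∑<-*ˡ : (n k : ℕ) (g : ℕ → ℕ) → ∑< n (λ x → k * g x) ≡ k * ∑< n g
∑<-*ˡ n k g = ∑-*ˡ {n} k (g ∘ toℕ)

∑<-1 : (n : ℕ) → ∑< n (λ _ → 1) ≡ n
∑<-1 n = trans (∑-const n 1) (ℕ.*-identityʳ n)

∣x-n∣ : {x n : ℕ} → x < n → ∣ x - n ∣ ≡ n ∸ x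
∣x-n∣ x<n = ℕ.m≤n⇒∣m-n∣≡n∸m (ℕ.<⇒≤ x<n)

∣n-x∣ : {x n : ℕ} → x < n → ∣ n - x ∣ ≡ n ∸ x
∣n-x∣ {x} {n} x<n = trans (ℕ.∣-∣-comm n x) (∣x-n∣ x<n)

1+n∸x : {x n : ℕ} → x < n → suc n ∸ x ≡ suc (n ∸ x)
1+n∸x x<n = ℕ.+-∸-assoc 1 (ℕ.<⇒≤ x<n)

1+n∸n : (n : ℕ) → suc n ∸ n ≡ 1
1+n∸n n = ℕ.m+n∸n≡m 1 n

triangular squarePyramidal : ℕ → ℕ
triangular n = ∑< n (n ∸_)
squarePyramidal n = ∑< n (λ x → (n ∸ x) * (n ∸ x))

rowDistance : ℕ → ℕ → ℕ
rowDistance n x = ∑< n (λ y → ∣ x - y ∣)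

distanceSum distanceSquareSum rowGapSum rowSquareSum : ℕ → ℕ
distanceSum n = ∑< n (rowDistance n)
distanceSquareSum n = ∑< n (λ x → ∑< n (λ y → ∣ x - y ∣ * ∣ x - y ∣))
rowGapSum n = ∑< n (λ x → rowDistance n x * (n ∸ x))
rowSquareSum n = ∑< n (λ x → rowDistance n x * rowDistance n x)

∑<-+₃ : (n : ℕ) (g h k : ℕ → ℕ) → ∑< n (λ x → g x + h x + k x) ≡ ∑< n g + ∑< n h + ∑< n k
∑<-+₃ n g h k = trans (∑<-+ n (λ x → g x + h x) k) (cong (_+ ∑< n k) (∑<-+ n g h))

∑<-+₄ : (n : ℕ) (g h k l : ℕ → ℕ) →
        ∑< n (λ x → g x + h x + k x + l x) ≡ ∑< n g + ∑< n h + ∑< n k + ∑< n l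
∑<-+₄ n g h k l = trans (∑<-+ n (λ x → g x + h x + k x) l) (cong (_+ ∑< n l) (∑<-+₃ n g h k))

rowDistance-suc : (n x : ℕ) → x < n → rowDistance (suc n) x ≡ rowDistance n x + (n ∸ x)
rowDistance-suc n x x<n = trans (∑<-last n (λ y → ∣ x - y ∣)) (cong (rowDistance n x +_) (∣x-n∣ x<n))

rowDistance-last : (n : ℕ) → rowDistance (suc n) n ≡ triangular n
rowDistance-last n = begin
  rowDistance (suc n) n      ≡⟨ ∑<-last n (λ y → ∣ n - y ∣) ⟩
  rowDistance n n + ∣ n - n ∣ ≡⟨ cong₂ _+_ (∑<-cong n (λ y y<n → ∣n-x∣ y<n)) (ℕ.∣n-n∣≡0 n) ⟩
  triangular n + 0           ≡⟨ ℕ.+-identityʳ (triangular n) ⟩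
  triangular n               ∎
  where open ≡-Reasoning

triangular-suc : (n : ℕ) → triangular (suc n) ≡ n + triangular n + 1
triangular-suc n = begin
  triangular (suc n)                          ≡⟨ ∑<-last n (suc n ∸_) ⟩
  ∑< n (suc n ∸_) + (suc n ∸ n)               ≡⟨ cong₂ _+_ (∑<-cong n (λ x x<n → 1+n∸x x<n)) (1+n∸n n) ⟩
  ∑< n (λ x → 1 + (n ∸ x)) + 1                ≡⟨ cong (_+ 1) (∑<-+ n (λ _ → 1) (n ∸_)) ⟩
  ∑< n (λ _ → 1) + triangular n + 1           ≡⟨ cong (λ t → t + triangular n + 1) (∑<-1 n) ⟩
  n + triangular n + 1                        ∎
  where open ≡-Reasoning

squarePyramidal-suc : (n : ℕ) → squarePyramidal (suc n) ≡ n + 2 * triangular n + squarePyramidal n + 1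
squarePyramidal-suc n = begin
  squarePyramidal (suc n)
    ≡⟨ ∑<-last n (λ x → (suc n ∸ x) * (suc n ∸ x)) ⟩
  ∑< n (λ x → (suc n ∸ x) * (suc n ∸ x)) + (suc n ∸ n) * (suc n ∸ n)
    ≡⟨ cong₂ _+_ (∑<-cong n (λ x x<n → trans (cong₂ _*_ (1+n∸x x<n) (1+n∸x x<n)) (square-suc (n ∸ x))))
                 (cong (λ t → t * t) (1+n∸n n)) ⟩
  ∑< n (λ x → 1 + 2 * (n ∸ x) + (n ∸ x) * (n ∸ x)) + 1
    ≡⟨ cong (_+ 1) (∑<-+₃ n (λ _ → 1) (λ x → 2 * (n ∸ x)) (λ x → (n ∸ x) * (n ∸ x))) ⟩
  ∑< n (λ _ → 1) + ∑< n (λ x → 2 * (n ∸ x)) + squarePyramidal n + 1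
    ≡⟨ cong₂ (λ s t → s + t + squarePyramidal n + 1) (∑<-1 n) (∑<-*ˡ n 2 (n ∸_)) ⟩
  n + 2 * triangular n + squarePyramidal n + 1 ∎
  where
  open ≡-Reasoning
  square-suc : ∀ d → suc d * suc d ≡ 1 + 2 * d + d * d
  square-suc = solve-∀

distanceSum-suc : (n : ℕ) → distanceSum (suc n) ≡ distanceSum n + triangular n + triangular n
distanceSum-suc n = begin
  distanceSum (suc n)
    ≡⟨ ∑<-last n (rowDistance (suc n)) ⟩
  ∑< n (rowDistance (suc n)) + rowDistance (suc n) n
    ≡⟨ cong₂ _+_ (∑<-cong n (rowDistance-suc n)) (rowDistance-last n) ⟩
  ∑< n (λ x → rowDistance n x + (n ∸ x)) + triangular n
    ≡⟨ cong (_+ triangular n) (∑<-+ n (rowDistance n) (n ∸_)) ⟩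
  distanceSum n + triangular n + triangular n ∎
  where open ≡-Reasoning

distanceSquareSum-suc : (n : ℕ) →
  distanceSquareSum (suc n) ≡ distanceSquareSum n + squarePyramidal n + squarePyramidal n
distanceSquareSum-suc n = begin
  distanceSquareSum (suc n)
    ≡⟨ ∑<-last n (squares (suc n)) ⟩
  ∑< n (squares (suc n)) + squares (suc n) n
    ≡⟨ cong₂ _+_ (∑<-cong n (λ x x<n → trans (∑<-last n (λ y → ∣ x - y ∣ * ∣ x - y ∣))
                                               (cong (λ t → squares n x + t * t) (∣x-n∣ x<n))))
                 (trans (∑<-last n (λ y → ∣ n - y ∣ * ∣ n - y ∣))
                        (trans (cong₂ _+_ (∑<-cong n (λ y y<n → cong (λ t → t * t) (∣n-x∣ y<n)))
                                          (cong (λ t → t * t) (ℕ.∣n-n∣≡0 n)))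
                               (ℕ.+-identityʳ (squarePyramidal n)))) ⟩
  ∑< n (λ x → squares n x + (n ∸ x) * (n ∸ x)) + squarePyramidal n
    ≡⟨ cong (_+ squarePyramidal n) (∑<-+ n (squares n) (λ x → (n ∸ x) * (n ∸ x))) ⟩
  distanceSquareSum n + squarePyramidal n + squarePyramidal n ∎
  where
  open ≡-Reasoning
  squares : ℕ → ℕ → ℕ
  squares n x = ∑< n (λ y → ∣ x - y ∣ * ∣ x - y ∣)

rowGapSum-suc : (n : ℕ) → rowGapSum (suc n) ≡
  distanceSum n + rowGapSum n + triangular n + squarePyramidal n + triangular n
rowGapSum-suc n = begin
  rowGapSum (suc n)
    ≡⟨ ∑<-last n (λ x → rowDistance (suc n) x * (suc n ∸ x)) ⟩
  ∑< n (λ x → rowDistance (suc n) x * (suc n ∸ x)) + rowDistance (suc n) n * (suc n ∸ n)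
    ≡⟨ cong₂ _+_ (∑<-cong n (λ x x<n → trans (cong₂ _*_ (rowDistance-suc n x x<n) (1+n∸x x<n))
                                               (expand (rowDistance n x) (n ∸ x))))
                 (trans (cong₂ _*_ (rowDistance-last n) (1+n∸n n)) (ℕ.*-identityʳ (triangular n))) ⟩
  ∑< n (λ x → rowDistance n x + rowDistance n x * (n ∸ x) + (n ∸ x) + (n ∸ x) * (n ∸ x)) + triangular n
    ≡⟨ cong (_+ triangular n) (∑<-+₄ n (rowDistance n) (λ x → rowDistance n x * (n ∸ x)) (n ∸_)
                                      (λ x → (n ∸ x) * (n ∸ x))) ⟩
  distanceSum n + rowGapSum n + triangular n + squarePyramidal n + triangular n ∎
  where
  open ≡-Reasoning
  expand : ∀ r d → (r + d) * suc d ≡ r + r * d + d + d * d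
  expand = solve-∀

rowSquareSum-suc : (n : ℕ) → rowSquareSum (suc n) ≡
  rowSquareSum n + 2 * rowGapSum n + squarePyramidal n + triangular n * triangular n
rowSquareSum-suc n = begin
  rowSquareSum (suc n)
    ≡⟨ ∑<-last n (λ x → rowDistance (suc n) x * rowDistance (suc n) x) ⟩
  ∑< n (λ x → rowDistance (suc n) x * rowDistance (suc n) x) + rowDistance (suc n) n * rowDistance (suc n) n
    ≡⟨ cong₂ _+_ (∑<-cong n (λ x x<n → trans (cong (λ t → t * t) (rowDistance-suc n x x<n))
                                               (expand (rowDistance n x) (n ∸ x))))
                 (cong (λ t → t * t) (rowDistance-last n)) ⟩
  ∑< n (λ x → rowDistance n x * rowDistance n x + 2 * (rowDistance n x * (n ∸ x)) + (n ∸ x) * (n ∸ x))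
    + triangular n * triangular n
    ≡⟨ cong (_+ triangular n * triangular n)
         (trans (∑<-+₃ n (λ x → rowDistance n x * rowDistance n x) (λ x → 2 * (rowDistance n x * (n ∸ x)))
                         (λ x → (n ∸ x) * (n ∸ x)))
                (cong (λ t → rowSquareSum n + t + squarePyramidal n)
                      (∑<-*ˡ n 2 (λ x → rowDistance n x * (n ∸ x))))) ⟩
  rowSquareSum n + 2 * rowGapSum n + squarePyramidal n + triangular n * triangular n ∎
  where
  open ≡-Reasoning
  expand : ∀ r d → (r + d) * (r + d) ≡ r * r + 2 * (r * d) + d * d
  expand = solve-∀

triangular-formula : (n : ℕ) → 2 * triangular n ≡ n * n + n
triangular-formula zero = refl
triangular-formula (suc n) = begin
  2 * triangular (suc n)              ≡⟨ cong (2 *_) (triangular-suc n) ⟩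
  2 * (n + triangular n + 1)          ≡⟨ distrib n (triangular n) ⟩
  2 * triangular n + (2 * n + 2)      ≡⟨ cong (_+ (2 * n + 2)) (triangular-formula n) ⟩
  n * n + n + (2 * n + 2)             ≡⟨ step n ⟩
  suc n * suc n + suc n               ∎
  where
  open ≡-Reasoning
  distrib : ∀ n t → 2 * (n + t + 1) ≡ 2 * t + (2 * n + 2)
  distrib = solve-∀
  step : ∀ n → n * n + n + (2 * n + 2) ≡ suc n * suc n + suc n
  step = solve-∀

squarePyramidal-formula : (n : ℕ) → 6 * squarePyramidal n ≡ 2 * (n * n * n) + 3 * (n * n) + n
squarePyramidal-formula zero = refl
squarePyramidal-formula (suc n) = begin
  6 * squarePyramidal (suc n)
    ≡⟨ cong (6 *_) (squarePyramidal-suc n) ⟩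
  6 * (n + 2 * triangular n + squarePyramidal n + 1)
    ≡⟨ distrib n (triangular n) (squarePyramidal n) ⟩
  6 * n + 6 * (2 * triangular n) + 6 * squarePyramidal n + 6
    ≡⟨ cong₂ (λ t s → 6 * n + 6 * t + s + 6) (triangular-formula n) (squarePyramidal-formula n) ⟩
  6 * n + 6 * (n * n + n) + (2 * (n * n * n) + 3 * (n * n) + n) + 6
    ≡⟨ step n ⟩
  2 * (suc n * suc n * suc n) + 3 * (suc n * suc n) + suc n ∎
  where
  open ≡-Reasoning
  distrib : ∀ n t s → 6 * (n + 2 * t + s + 1) ≡ 6 * n + 6 * (2 * t) + 6 * s + 6
  distrib = solve-∀
  step : ∀ n → 6 * n + 6 * (n * n + n) + (2 * (n * n * n) + 3 * (n * n) + n) + 6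
             ≡ 2 * (suc n * suc n * suc n) + 3 * (suc n * suc n) + suc n
  step = solve-∀

distanceSum-formula : (n : ℕ) → 3 * distanceSum n + n ≡ n * n * n
distanceSum-formula zero = refl
distanceSum-formula (suc n) = begin
  3 * distanceSum (suc n) + suc n
    ≡⟨ cong (λ p → 3 * p + suc n) (distanceSum-suc n) ⟩
  3 * (distanceSum n + triangular n + triangular n) + suc n
    ≡⟨ distrib n (distanceSum n) (triangular n) ⟩
  (3 * distanceSum n + n) + 3 * (2 * triangular n) + 1
    ≡⟨ cong₂ (λ p t → p + 3 * t + 1) (distanceSum-formula n) (triangular-formula n) ⟩
  n * n * n + 3 * (n * n + n) + 1
    ≡⟨ step n ⟩
  suc n * suc n * suc n ∎
  where
  open ≡-Reasoning
  distrib : ∀ n p t → 3 * (p + t + t) + suc n ≡ (3 * p + n) + 3 * (2 * t) + 1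
  distrib = solve-∀
  step : ∀ n → n * n * n + 3 * (n * n + n) + 1 ≡ suc n * suc n * suc n
  step = solve-∀

distanceSquareSum-formula : (n : ℕ) → 6 * distanceSquareSum n + n * n ≡ n * n * n * n
distanceSquareSum-formula zero = refl
distanceSquareSum-formula (suc n) = begin
  6 * distanceSquareSum (suc n) + suc n * suc n
    ≡⟨ cong (λ r → 6 * r + suc n * suc n) (distanceSquareSum-suc n) ⟩
  6 * (distanceSquareSum n + squarePyramidal n + squarePyramidal n) + suc n * suc n
    ≡⟨ distrib n (distanceSquareSum n) (squarePyramidal n) ⟩
  (6 * distanceSquareSum n + n * n) + 2 * (6 * squarePyramidal n) + 2 * n + 1
    ≡⟨ cong₂ (λ r s → r + 2 * s + 2 * n + 1) (distanceSquareSum-formula n) (squarePyramidal-formula n) ⟩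
  n * n * n * n + 2 * (2 * (n * n * n) + 3 * (n * n) + n) + 2 * n + 1
    ≡⟨ step n ⟩
  suc n * suc n * suc n * suc n ∎
  where
  open ≡-Reasoning
  distrib : ∀ n r s → 6 * (r + s + s) + suc n * suc n ≡ (6 * r + n * n) + 2 * (6 * s) + 2 * n + 1
  distrib = solve-∀
  step : ∀ n → n * n * n * n + 2 * (2 * (n * n * n) + 3 * (n * n) + n) + 2 * n + 1 ≡ suc n * suc n * suc n * suc n
  step = solve-∀

-- Both sides are enlarged by 3 n + n², which lets the induction hypotheses be
-- substituted without any subtraction; rowSquareSum-formula works the same way.
rowGapSum-formula : (n : ℕ) → 6 * rowGapSum n + n + n * n ≡ n * n * n + n * n * n * n
rowGapSum-formula zero = refl
rowGapSum-formula (suc n) = ℕ.+-cancelʳ-≡ (3 * n + n * n) _ _ (begin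
  6 * rowGapSum (suc n) + suc n + suc n * suc n + (3 * n + n * n)
    ≡⟨ cong (λ e → 6 * e + suc n + suc n * suc n + (3 * n + n * n)) (rowGapSum-suc n) ⟩
  6 * (P + E + T + S + T) + suc n + suc n * suc n + (3 * n + n * n)
    ≡⟨ distrib n P E T S ⟩
  2 * (3 * P + n) + (6 * E + n + n * n) + 6 * (2 * T) + 6 * S + suc n + suc n * suc n
    ≡⟨ cong₂ (λ p e → 2 * p + e + 6 * (2 * T) + 6 * S + suc n + suc n * suc n)
             (distanceSum-formula n) (rowGapSum-formula n) ⟩
  2 * (n * n * n) + (n * n * n + n * n * n * n) + 6 * (2 * T) + 6 * S + suc n + suc n * suc n
    ≡⟨ cong₂ (λ t s → 2 * (n * n * n) + (n * n * n + n * n * n * n) + 6 * t + s + suc n + suc n * suc n)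
             (triangular-formula n) (squarePyramidal-formula n) ⟩
  2 * (n * n * n) + (n * n * n + n * n * n * n) + 6 * (n * n + n)
    + (2 * (n * n * n) + 3 * (n * n) + n) + suc n + suc n * suc n
    ≡⟨ step n ⟩
  suc n * suc n * suc n + suc n * suc n * suc n * suc n + (3 * n + n * n) ∎)
  where
  open ≡-Reasoning
  P E T S : ℕ
  P = distanceSum n
  E = rowGapSum n
  T = triangular n
  S = squarePyramidal n
  distrib : ∀ n p e t s → 6 * (p + e + t + s + t) + suc n + suc n * suc n + (3 * n + n * n)
                        ≡ 2 * (3 * p + n) + (6 * e + n + n * n) + 6 * (2 * t) + 6 * s + suc n + suc n * suc n
  distrib = solve-∀
  step : ∀ n → 2 * (n * n * n) + (n * n * n + n * n * n * n) + 6 * (n * n + n)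
               + (2 * (n * n * n) + 3 * (n * n) + n) + suc n + suc n * suc n
             ≡ suc n * suc n * suc n + suc n * suc n * suc n * suc n + (3 * n + n * n)
  step = solve-∀

rowSquareSum-formula : (n : ℕ) → 60 * rowSquareSum n + 15 * (n * n * n) ≡ 7 * (n * n * n * n * n) + 8 * n
rowSquareSum-formula zero = refl
rowSquareSum-formula (suc n) = ℕ.+-cancelʳ-≡ (15 * (n * n * n) + 20 * n + 20 * (n * n)) _ _ (begin
  60 * rowSquareSum (suc n) + 15 * (suc n * suc n * suc n) + (15 * (n * n * n) + 20 * n + 20 * (n * n))
    ≡⟨ cong (λ q → 60 * q + 15 * (suc n * suc n * suc n) + (15 * (n * n * n) + 20 * n + 20 * (n * n)))
            (rowSquareSum-suc n) ⟩
  60 * (Q + 2 * E + S + T * T) + 15 * (suc n * suc n * suc n) + (15 * (n * n * n) + 20 * n + 20 * (n * n))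
    ≡⟨ distrib n Q E S T ⟩
  (60 * Q + 15 * (n * n * n)) + 20 * (6 * E + n + n * n) + 10 * (6 * S) + 15 * ((2 * T) * (2 * T))
    + 15 * (suc n * suc n * suc n)
    ≡⟨ cong₂ (λ q e → q + 20 * e + 10 * (6 * S) + 15 * ((2 * T) * (2 * T)) + 15 * (suc n * suc n * suc n))
             (rowSquareSum-formula n) (rowGapSum-formula n) ⟩
  7 * (n * n * n * n * n) + 8 * n + 20 * (n * n * n + n * n * n * n) + 10 * (6 * S) + 15 * ((2 * T) * (2 * T))
    + 15 * (suc n * suc n * suc n)
    ≡⟨ cong₂ (λ s t → 7 * (n * n * n * n * n) + 8 * n + 20 * (n * n * n + n * n * n * n) + 10 * s
                      + 15 * (t * t) + 15 * (suc n * suc n * suc n))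
             (squarePyramidal-formula n) (triangular-formula n) ⟩
  7 * (n * n * n * n * n) + 8 * n + 20 * (n * n * n + n * n * n * n) + 10 * (2 * (n * n * n) + 3 * (n * n) + n)
    + 15 * ((n * n + n) * (n * n + n)) + 15 * (suc n * suc n * suc n)
    ≡⟨ step n ⟩
  7 * (suc n * suc n * suc n * suc n * suc n) + 8 * suc n + (15 * (n * n * n) + 20 * n + 20 * (n * n)) ∎)
  where
  open ≡-Reasoning
  Q E S T : ℕ
  Q = rowSquareSum n
  E = rowGapSum n
  S = squarePyramidal n
  T = triangular n
  distrib : ∀ n q e s t → 60 * (q + 2 * e + s + t * t) + 15 * (suc n * suc n * suc n) + (15 * (n * n * n) + 20 * n + 20 * (n * n))
                        ≡ (60 * q + 15 * (n * n * n)) + 20 * (6 * e + n + n * n) + 10 * (6 * s) + 15 * ((2 * t) * (2 * t))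
                          + 15 * (suc n * suc n * suc n)
  distrib = solve-∀
  step : ∀ n → 7 * (n * n * n * n * n) + 8 * n + 20 * (n * n * n + n * n * n * n) + 10 * (2 * (n * n * n) + 3 * (n * n) + n)
                 + 15 * ((n * n + n) * (n * n + n)) + 15 * (suc n * suc n * suc n)
               ≡ 7 * (suc n * suc n * suc n * suc n * suc n) + 8 * suc n + (15 * (n * n * n) + 20 * n + 20 * (n * n))
  step = solve-∀

distance : Fin n → Fin n → ℕ
distance x y = ∣ toℕ x - toℕ y ∣

disjointPairSum : ℕ → ℕ
disjointPairSum n = ∑⁴ (λ x y z w → distinct₄ {n} x y z w * (distance x y * distance z w))

-- With n = 4 + k the truncated subtractions n ∸ 1, n ∸ 2, n ∸ 3 compute, so the
-- identity becomes polynomial in k; pP, pR, pQ are 3 P, 6 R, 60 Q in factored form.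
disjointPairSum-formula : (k : ℕ) → let n = 4 + k in
  45 * disjointPairSum n ≡ n * ((n ∸ 1) * ((n ∸ 2) * (n ∸ 3))) * ((n + 1) * (5 * n + 4))
disjointPairSum-formula k = ℕ.+-cancelʳ-≡ (3 * pQ) _ _ (begin
  45 * T + 3 * pQ                              ≡⟨ cong (λ q → 45 * T + 3 * q) hQ ⟨
  45 * T + 3 * (60 * Q)                        ≡⟨ scale T Q ⟩
  45 * (T + 4 * Q)                             ≡⟨ cong (45 *_) (inclusion-exclusion) ⟩
  45 * (P * P + 2 * R)                         ≡⟨ rescale P R ⟩
  5 * ((3 * P) * (3 * P)) + 15 * (6 * R)       ≡⟨ cong₂ (λ p r → 5 * (p * p) + 15 * r) hP hR ⟩
  5 * (pP * pP) + 15 * pR                      ≡⟨ polynomial k ⟩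
  D * K + 3 * pQ                               ∎)
  where
  open ≡-Reasoning
  open SymmetricWeight (distance {4 + k}) (λ x → ℕ.∣n-n∣≡0 (toℕ x)) (λ x y → ℕ.∣-∣-comm (toℕ x) (toℕ y))
  N T P Q R D K pP pR pQ : ℕ
  N = 4 + k
  T = disjointPairSum N
  P = distanceSum N
  Q = rowSquareSum N
  R = distanceSquareSum N
  D = N * ((N ∸ 1) * ((N ∸ 2) * (N ∸ 3)))
  K = (N + 1) * (5 * N + 4)
  pP = (3 + k) * (4 + k) * (5 + k)
  pR = (4 + k) * (4 + k) * (3 + k) * (5 + k)
  pQ = (3 + k) * (4 + k) * (5 + k) * (7 * (k * k) + 56 * k + 104)
  hP : 3 * P ≡ pP
  hP = ℕ.+-cancelʳ-≡ N _ _ (trans (distanceSum-formula N) (cube k))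
    where cube : ∀ k → (4 + k) * (4 + k) * (4 + k) ≡ (3 + k) * (4 + k) * (5 + k) + (4 + k)
          cube = solve-∀
  hR : 6 * R ≡ pR
  hR = ℕ.+-cancelʳ-≡ (N * N) _ _ (trans (distanceSquareSum-formula N) (fourth k))
    where fourth : ∀ k → (4 + k) * (4 + k) * (4 + k) * (4 + k) ≡ (4 + k) * (4 + k) * (3 + k) * (5 + k) + (4 + k) * (4 + k)
          fourth = solve-∀
  hQ : 60 * Q ≡ pQ
  hQ = ℕ.+-cancelʳ-≡ (15 * (N * N * N)) _ _ (trans (rowSquareSum-formula N) (quintic k))
    where quintic : ∀ k → 7 * ((4 + k) * (4 + k) * (4 + k) * (4 + k) * (4 + k)) + 8 * (4 + k)
                          ≡ (3 + k) * (4 + k) * (5 + k) * (7 * (k * k) + 56 * k + 104) + 15 * ((4 + k) * (4 + k) * (4 + k))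
          quintic = solve-∀
  scale : ∀ t q → 45 * t + 3 * (60 * q) ≡ 45 * (t + 4 * q)
  scale = solve-∀
  rescale : ∀ p r → 45 * (p * p + 2 * r) ≡ 5 * ((3 * p) * (3 * p)) + 15 * (6 * r)
  rescale = solve-∀
  polynomial : ∀ k → 5 * (((3 + k) * (4 + k) * (5 + k)) * ((3 + k) * (4 + k) * (5 + k))) + 15 * ((4 + k) * (4 + k) * (3 + k) * (5 + k))
                     ≡ (4 + k) * ((3 + k) * ((2 + k) * (1 + k))) * ((4 + k + 1) * (5 * (4 + k) + 4))
                       + 3 * ((3 + k) * (4 + k) * (5 + k) * (7 * (k * k) + 56 * k + 104))
  polynomial = solve-∀

mainTheorem4 : (n : ℕ) → 4 ≤ n → (a b c e : Fin n) →
    a ≢ b → a ≢ c → a ≢ e → b ≢ c → b ≢ e → c ≢ e →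
    (L : List (Fin n → Fin n)) → EnumeratesPerms n L →
    45 * sum (map (λ π → dist π a b * dist π c e) L) ≡ length L * ((n + 1) * (5 * n + 4))
mainTheorem4 0 ()
mainTheorem4 1 (s≤s ())
mainTheorem4 2 (s≤s (s≤s ()))
mainTheorem4 3 (s≤s (s≤s (s≤s ())))
mainTheorem4 n@(suc (suc (suc (suc k)))) _ a b c e a≢b a≢c a≢e b≢c b≢e c≢e L enum = begin
  45 * sum (map (λ π → dist π a b * dist π c e) L)
    ≡⟨ cong (45 *_) (trans (sum-map (λ π → dist π a b * dist π c e) L)
                           (∑-arrangements (λ x y z w → distance x y * distance z w))) ⟩
  45 * (C * disjointPairSum n)     ≡⟨ x∙yz≈y∙xz 45 C (disjointPairSum n) ⟩
  C * (45 * disjointPairSum n)     ≡⟨ cong (C *_) (disjointPairSum-formula k) ⟩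
  C * (D * K)                      ≡⟨ cong (λ d → C * (d * K)) (∑⁴-distinct₄ n) ⟨
  C * (∑⁴ (distinct₄ {n}) * K)     ≡⟨ ℕ.*-assoc C _ K ⟨
  C * ∑⁴ (distinct₄ {n}) * K       ≡⟨ cong (_* K) length≡C*∑⁴distinct₄ ⟨
  length L * K                     ∎
  where
  open ≡-Reasoning
  open Arrangements L enum
  open Quadruple a≢b a≢c a≢e b≢c b≢e c≢e
  D K : ℕ
  D = n * ((n ∸ 1) * ((n ∸ 2) * (n ∸ 3)))
  K = (n + 1) * (5 * n + 4)
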